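{- Let $n>1$ be an integer with $n-1=\prod_{i=1}^k p_i^{s_i}$, where $p_1,\dots,p_k$ are distinct primes and $s_i\ge 1$. Let $m=\prod_{i=1}^k p_i^{t_i}$ with integers $0\le t_i\le s_i$, and suppose that $n$ has the property that if $m\mid\varphi(n)$ then $n$ is prime. If for each $i$ with $t_i\ge 1$ (i.e. each prime $p_i$ dividing $m$) there exists an integer $b_i$ such that $b_i^{\,n-1}\equiv 1\pmod n$ and $b_i^{\,(n-1)/p_i^{\,s_i-t_i+1}}\not\equiv 1\pmod n$, then $n$ is prime.
   Context: $\varphi$ denotes Euler's totient function. -}

module Defs where

open import Data.Nat using (ℕ; suc; _∸_)
open import Data.Nat.GCD using (gcd)
open import Data.Nat.Properties using (_≟_)
open import Data.Fin using (Fin)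
open import Data.List using (List; length; filter; upTo; map; allFin)
open import Data.Nat.ListAction using (product)
open import Data.Integer as ℤ using (ℤ; +_)
open import Data.Integer.Divisibility as ℤD using ()

-- Euler's totient: φ n = #{ k ∈ {1,…,n} : gcd k n = 1 }  (so φ 0 = 0, φ 1 = 1).
φ : ℕ → ℕ
φ n = length (filter (λ k → gcd (suc k) n ≟ 1) (upTo n))

∏ : (k : ℕ) → (Fin k → ℕ) → ℕ
∏ k f = product (map f (allFin k))

_≡_[mod_] : ℤ → ℤ → ℕ → Set
a ≡ b [mod n ] = (+ n) ℤD.∣ (a ℤ.- b)

{-# OPTIONS --safe #-}
module Submission where

-- Fix a prime p = pᵢ with t = tᵢ ≥ 1 and write n − 1 = p^s · r. Any witness b is a unit
-- mod n, so by Euler's theorem and Bézout, b ^ gcd (n − 1) (φ n) ≡ 1. The gcd divides p^s · r,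
-- hence either p^t divides it (and so φ n), or it divides p^(t−1) · r = (n − 1) / p^(s−t+1),
-- which the witness excludes. The distinct prime powers pᵢ^tᵢ are pairwise coprime, so
-- their product m divides φ n, and n is prime by hypothesis.

open import Defs
open import Data.Nat.Base using (ℕ)

module ModularArithmetic (n : ℕ) where

  open import Data.Nat as ℕ using (zero; suc)
  import Data.Nat.Properties as ℕ
  import Data.Nat.Divisibility as ℕ
  open import Data.Nat.Coprimality using (Coprime; coprime-Bézout)
  open import Data.Nat.GCD using (gcd; module Bézout; gcd-GCD)
  open import Data.Nat.ListAction using (product)
  open import Data.Integer hiding (suc; NonZero)
  open import Data.Integer.Properties
  open import Data.Integer.DivMod using (_%ℕ_; _/ℕ_; a≡a%ℕn+[a/ℕn]*n)
  open import Data.Integer.Divisibility.Signed as Signed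
    using (divides; ∣ᵤ⇒∣; ∣⇒∣ᵤ; ∣m∣n⇒∣m+n; ∣m∣n⇒∣m-n; ∣m⇒∣-m; ∣n⇒∣m*n; ∣m⇒∣m*n)
  open import Data.Integer.Tactic.RingSolver using (solve-∀)
  open import Data.List using ([]; _∷_)
  open import Data.List.Membership.Propositional using (_∈_)
  open import Data.List.Relation.Unary.Any using (here; there)
  open import Data.Product using (_,_)
  open import Function using (_∘′_)
  open import Level using (0ℓ)
  open import Relation.Binary using (Setoid)
  import Relation.Binary.Reasoning.Setoid
  open import Relation.Binary.PropositionalEquality
  open import Relation.Nullary using (contradiction)

  infix 4 _≈_

  -- A record rather than a synonym for _≡_[mod n ], so that a and b can be inferred; it stores
  -- signed divisibility, for which the library has the additive and multiplicative lemmas.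
  record _≈_ (a b : ℤ) : Set where
    constructor mod
    field n∣a-b : + n Signed.∣ a - b

  private variable
    e f m : ℕ
    a b c d : ℤ

  mod⇒≈ : a ≡ b [mod n ] → a ≈ b
  mod⇒≈ = mod ∘′ ∣ᵤ⇒∣

  ≈⇒mod : a ≈ b → a ≡ b [mod n ]
  ≈⇒mod (mod n∣a-b) = ∣⇒∣ᵤ n∣a-b

  ≈-refl : a ≈ a
  ≈-refl {a} = mod (divides 0ℤ (+-inverseʳ a))

  ≈-sym : a ≈ b → b ≈ a
  ≈-sym {a} {b} (mod n∣a-b) = mod (subst (_ Signed.∣_) (negate a b) (∣m⇒∣-m n∣a-b))
    where
    negate : ∀ a b → - (a - b) ≡ b - a
    negate = solve-∀

  ≈-trans : a ≈ b → b ≈ c → a ≈ c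
  ≈-trans {a} {b} {c} (mod n∣a-b) (mod n∣b-c) =
    mod (subst (_ Signed.∣_) (telescope a b c) (∣m∣n⇒∣m+n n∣a-b n∣b-c))
    where
    telescope : ∀ a b c → (a - b) + (b - c) ≡ a - c
    telescope = solve-∀

  ≈-setoid : Setoid 0ℓ 0ℓ
  ≈-setoid = record
    { Carrier       = ℤ
    ; _≈_           = _≈_
    ; isEquivalence = record { refl = ≈-refl ; sym = ≈-sym ; trans = ≈-trans }
    }

  module ≈-Reasoning = Relation.Binary.Reasoning.Setoid ≈-setoid

  *-cong-≈ : a ≈ b → c ≈ d → a * c ≈ b * d
  *-cong-≈ {a} {b} {c} {d} (mod n∣a-b) (mod n∣c-d) =
    mod (subst (_ Signed.∣_) (split a b c d) (∣m∣n⇒∣m+n (∣n⇒∣m*n a n∣c-d) (∣m⇒∣m*n d n∣a-b)))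
    where
    split : ∀ a b c d → a * (c - d) + (a - b) * d ≡ a * c - b * d
    split = solve-∀

  ^-cong-≈ : a ≈ b → ∀ e → a ^ e ≈ b ^ e
  ^-cong-≈ a≈b zero    = ≈-refl
  ^-cong-≈ a≈b (suc e) = *-cong-≈ a≈b (^-cong-≈ a≈b e)

  %ℕ-≈ : .{{_ : ℕ.NonZero n}} → ∀ a → + (a %ℕ n) ≈ a
  %ℕ-≈ a = mod (divides (- q) (begin
    + r - a               ≡⟨ cong (λ x → + r - x) (a≡a%ℕn+[a/ℕn]*n a n) ⟩
    + r - (+ r + q * + n) ≡⟨ cancel (+ r) q (+ n) ⟩
    - q * + n             ∎))
    where
    open ≡-Reasoning
    r = a %ℕ n
    q = a /ℕ n
    cancel : ∀ r q n → r - (r + q * n) ≡ - q * n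
    cancel = solve-∀

  ≈-<-injective : ∀ {x y} → x ℕ.< n → y ℕ.< n → + x ≈ + y → x ≡ y
  ≈-<-injective {x} {y} x<n y<n (mod n∣x-y) with ∣ + x - + y ∣ in eq | ∣⇒∣ᵤ n∣x-y
  ... | zero  | _   = +-injective (i-j≡0⇒i≡j (+ x) (+ y) (∣i∣≡0⇒i≡0 eq))
  ... | suc d | n∣d = contradiction n∣d (ℕ.>⇒∤ (ℕ.≤-<-trans distance≤x⊔y (ℕ.⊔-pres-<m x<n y<n)))
    where
    distance≤x⊔y : suc d ℕ.≤ x ℕ.⊔ y
    distance≤x⊔y = subst (ℕ._≤ x ℕ.⊔ y) (trans (cong ∣_∣ (sym (m-n≡m⊖n x y))) eq) (∣m⊝n∣≤m⊔n x y)

  record Invertible (b : ℤ) : Set where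
    constructor inverse
    field
      b⁻¹     : ℤ
      b⁻¹*b≈1 : b⁻¹ * b ≈ 1ℤ

  invertible-resp-≈ : a ≈ b → Invertible a → Invertible b
  invertible-resp-≈ {a} {b} a≈b (inverse c ca≈1) = inverse c (begin
    c * b ≈⟨ *-cong-≈ (≈-refl {c}) (≈-sym a≈b) ⟩
    c * a ≈⟨ ca≈1 ⟩
    1ℤ    ∎)
    where open ≈-Reasoning

  invertible-* : Invertible a → Invertible b → Invertible (a * b)
  invertible-* {a} {b} (inverse c ca≈1) (inverse d db≈1) = inverse (c * d) (begin
    c * d * (a * b)   ≡⟨ interchange c d a b ⟩
    (c * a) * (d * b) ≈⟨ *-cong-≈ ca≈1 db≈1 ⟩
    1ℤ * 1ℤ           ≡⟨⟩
    1ℤ                ∎)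
    where
    open ≈-Reasoning
    interchange : ∀ c d a b → c * d * (a * b) ≡ (c * a) * (d * b)
    interchange = solve-∀

  invertible-product : ∀ {xs} → (∀ {x} → x ∈ xs → Invertible (+ x)) → Invertible (+ product xs)
  invertible-product {[]}     _        = inverse 1ℤ ≈-refl
  invertible-product {x ∷ xs} ∈⇒inv = subst Invertible (sym (pos-* x (product xs)))
    (invertible-* (∈⇒inv (here refl)) (invertible-product (∈⇒inv ∘′ there)))

  invertible-cancelˡ : Invertible c → c * a ≈ c * b → a ≈ b
  invertible-cancelˡ {c} {a} {b} (inverse d dc≈1) ca≈cb = begin
    a           ≡⟨ *-identityˡ a ⟨
    1ℤ * a      ≈⟨ *-cong-≈ (≈-sym dc≈1) (≈-refl {a}) ⟩
    d * c * a   ≡⟨ *-assoc d c a ⟩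
    d * (c * a) ≈⟨ *-cong-≈ (≈-refl {d}) ca≈cb ⟩
    d * (c * b) ≡⟨ *-assoc d c b ⟨
    d * c * b   ≈⟨ *-cong-≈ dc≈1 (≈-refl {b}) ⟩
    1ℤ * b      ≡⟨ *-identityˡ b ⟩
    b           ∎
    where open ≈-Reasoning

  ^-suc≈1⇒invertible : ∀ a e → a ^ suc e ≈ 1ℤ → Invertible a
  ^-suc≈1⇒invertible a e aᵉ⁺¹≈1 = inverse (a ^ e) (subst (_≈ 1ℤ) (*-comm a (a ^ e)) aᵉ⁺¹≈1)

  private
    pos-bézout : ∀ u v w z → 1 ℕ.+ u ℕ.* v ≡ w ℕ.* z → 1ℤ + + u * + v ≡ + w * + z
    pos-bézout u v w z eq = begin
      1ℤ + + u * + v    ≡⟨ cong (λ x → 1ℤ + x) (pos-* u v) ⟨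
      + (1 ℕ.+ u ℕ.* v) ≡⟨ cong +_ eq ⟩
      + (w ℕ.* z)       ≡⟨ pos-* w z ⟩
      + w * + z         ∎
      where open ≡-Reasoning

  coprime⇒invertible : Coprime m n → Invertible (+ m)
  coprime⇒invertible {m} m⊥n with coprime-Bézout m⊥n
  ... | Bézout.+- x y eq = inverse (+ x) (mod (divides (+ y) (begin
    + x * + m - 1ℤ      ≡⟨ cong (_- 1ℤ) (pos-bézout y n x m eq) ⟨
    1ℤ + + y * + n - 1ℤ ≡⟨ cancel (+ y * + n) ⟩
    + y * + n           ∎)))
    where
    open ≡-Reasoning
    cancel : ∀ u → 1ℤ + u - 1ℤ ≡ u
    cancel = solve-∀
  ... | Bézout.-+ x y eq = inverse (- + x) (mod (divides (- + y) (begin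
    - + x * + m - 1ℤ    ≡⟨ negate (+ x) (+ m) ⟩
    - (1ℤ + + x * + m)  ≡⟨ cong -_ (pos-bézout x m y n eq) ⟩
    - (+ y * + n)       ≡⟨ neg-distribˡ-* (+ y) (+ n) ⟩
    - + y * + n         ∎)))
    where
    open ≡-Reasoning
    negate : ∀ u v → - u * v - 1ℤ ≡ - (1ℤ + u * v)
    negate = solve-∀

  invertible⇒coprime : Invertible (+ m) → Coprime m n
  invertible⇒coprime {m} (inverse c (mod (divides q eq))) {d} (d∣m , d∣n) =
    ℕ.∣1⇒≡1 (∣⇒∣ᵤ (subst (_ Signed.∣_) (sym bézout)
      (∣m∣n⇒∣m-n (∣n⇒∣m*n c (∣ᵤ⇒∣ {+ d} {+ m} d∣m)) (∣n⇒∣m*n q (∣ᵤ⇒∣ {+ d} {+ n} d∣n)))))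
    where
    rearrange : ∀ u → 1ℤ ≡ u - (u - 1ℤ)
    rearrange = solve-∀
    bézout : 1ℤ ≡ c * + m - q * + n
    bézout = begin
      1ℤ                       ≡⟨ rearrange (c * + m) ⟩
      c * + m - (c * + m - 1ℤ) ≡⟨ cong (λ x → c * + m - x) eq ⟩
      c * + m - q * + n        ∎
      where open ≡-Reasoning

  ^-cancel-≈1 : ∀ a e f → a ^ f ≈ 1ℤ → a ^ (e ℕ.+ f) ≈ 1ℤ → a ^ e ≈ 1ℤ
  ^-cancel-≈1 a e f aᶠ≈1 aᵉ⁺ᶠ≈1 = begin
    a ^ e         ≡⟨ *-identityʳ (a ^ e) ⟨
    a ^ e * 1ℤ    ≈⟨ *-cong-≈ (≈-refl {a ^ e}) (≈-sym aᶠ≈1) ⟩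
    a ^ e * a ^ f ≡⟨ ^-distribˡ-+-* a e f ⟨
    a ^ (e ℕ.+ f) ≈⟨ aᵉ⁺ᶠ≈1 ⟩
    1ℤ            ∎
    where open ≈-Reasoning

  ^-∣-≈1 : ∀ a → e ℕ.∣ f → a ^ e ≈ 1ℤ → a ^ f ≈ 1ℤ
  ^-∣-≈1 {e} a (ℕ.divides q refl) aᵉ≈1 = begin
    a ^ (q ℕ.* e) ≡⟨ cong (a ^_) (ℕ.*-comm q e) ⟩
    a ^ (e ℕ.* q) ≡⟨ ^-*-assoc a e q ⟨
    (a ^ e) ^ q   ≈⟨ ^-cong-≈ aᵉ≈1 q ⟩
    1ℤ ^ q        ≡⟨ ^-zeroˡ q ⟩
    1ℤ            ∎
    where open ≈-Reasoning

  ^-gcd-≈1 : ∀ a e f → a ^ e ≈ 1ℤ → a ^ f ≈ 1ℤ → a ^ gcd e f ≈ 1ℤ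
  ^-gcd-≈1 a e f aᵉ≈1 aᶠ≈1 with Bézout.identity (gcd-GCD e f)
  ... | Bézout.+- x y eq = ^-cancel-≈1 a (gcd e f) (y ℕ.* f) (^-∣-≈1 a (ℕ.n∣m*n y) aᶠ≈1)
    (subst (λ k → a ^ k ≈ 1ℤ) (sym eq) (^-∣-≈1 a (ℕ.n∣m*n x) aᵉ≈1))
  ... | Bézout.-+ x y eq = ^-cancel-≈1 a (gcd e f) (x ℕ.* e) (^-∣-≈1 a (ℕ.n∣m*n x) aᵉ≈1)
    (subst (λ k → a ^ k ≈ 1ℤ) (sym eq) (^-∣-≈1 a (ℕ.n∣m*n y) aᶠ≈1))

module Totient where

  open import Data.Nat as ℕ using (zero; suc; _<_)
  import Data.Nat.Properties as ℕ
  open import Data.Nat.Coprimality using (Coprime; gcd≡1⇒coprime; coprime⇒gcd≡1; 0-coprimeTo-m⇒m≡1)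
  open import Data.Nat.Divisibility using (∣-refl)
  open import Data.Nat.GCD using (gcd)
  open import Data.Nat.ListAction using (product)
  open import Data.Nat.ListAction.Properties using (product-↭)
  open import Data.Integer as ℤ using (ℤ; +_; 1ℤ; _*_; _^_)
  import Data.Integer.Properties as ℤ
  open import Data.Integer.DivMod using (_%ℕ_; n%ℕd<d)
  open import Data.Integer.Tactic.RingSolver using (solve-∀)
  open import Data.List using (List; []; _∷_; map; filter; upTo; length)
  open import Data.List.Properties using (length-map)
  open import Data.List.Membership.Propositional using (_∈_)
  open import Data.List.Membership.Propositional.Properties
    using (∈-map⁺; ∈-map⁻; ∈-filter⁺; ∈-filter⁻; ∈-upTo⁺; ∈-upTo⁻)
  open import Data.List.Membership.Propositional.Properties.WithK using (unique∧set⇒bag)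
  open import Data.List.Relation.Binary.BagAndSetEquality using (∼bag⇒↭)
  open import Data.List.Relation.Binary.Permutation.Propositional using (_↭_)
  import Data.List.Relation.Unary.All as All
  import Data.List.Relation.Unary.All.Properties as All
  open import Data.List.Relation.Unary.Any using (here; there)
  open import Data.List.Relation.Unary.Unique.Propositional using (Unique; []; _∷_)
  import Data.List.Relation.Unary.Unique.Propositional.Properties as Unique
  open import Data.Product using (_×_; _,_; proj₁; proj₂)
  open import Data.Sum using (inj₁; inj₂)
  open import Function using (_∘′_)
  open import Function.Bundles using (mk⇔)
  open import Relation.Nullary using (¬_; Dec; contradiction)
  open import Relation.Binary.PropositionalEquality

  map⁺-Unique-on : ∀ {a b} {A : Set a} {B : Set b} {f : A → B} {xs : List A} →
    (∀ {x y} → x ∈ xs → y ∈ xs → f x ≡ f y → x ≡ y) → Unique xs → Unique (map f xs)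
  map⁺-Unique-on {xs = []}     _   []           = []
  map⁺-Unique-on {xs = x ∷ xs} inj (x∉xs ∷ uxs) =
    All.map⁺ (All.tabulate λ y∈xs fx≡fy → All.lookup x∉xs y∈xs (inj (here refl) (there y∈xs) fx≡fy))
    ∷ map⁺-Unique-on (λ x∈xs y∈xs → inj (there x∈xs) (there y∈xs)) uxs

  private
    coprime-suc? : ∀ n k → Dec (gcd (suc k) n ≡ 1)
    coprime-suc? n k = gcd (suc k) n ℕ.≟ 1

  reducedResidues : ℕ → List ℕ
  reducedResidues n = map suc (filter (coprime-suc? n) (upTo n))

  length-reducedResidues : ∀ n → length (reducedResidues n) ≡ φ n
  length-reducedResidues n = length-map suc (filter (coprime-suc? n) (upTo n))

  reducedResidues-unique : ∀ n → Unique (reducedResidues n)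
  reducedResidues-unique n = Unique.map⁺ ℕ.suc-injective (Unique.filter⁺ _ (Unique.upTo⁺ n))

  module _ {n : ℕ} (1<n : 1 < n) where

    open ModularArithmetic n

    private
      instance
        n≢0 : ℕ.NonZero n
        n≢0 = ℕ.>-nonZero (ℕ.<⇒≤ 1<n)

      ¬coprime-self : ¬ Coprime n n
      ¬coprime-self n⊥n = ℕ.<⇒≢ 1<n (sym (n⊥n (∣-refl , ∣-refl)))

    ∈-reducedResidues⁻ : ∀ {v} → v ∈ reducedResidues n → v < n × Invertible (+ v)
    ∈-reducedResidues⁻ v∈ with ∈-map⁻ suc v∈
    ... | k , k∈ , refl with ∈-filter⁻ (coprime-suc? n) {xs = upTo n} k∈
    ... | k∈upTo , gcd≡1 with ℕ.m≤n⇒m<n∨m≡n (∈-upTo⁻ k∈upTo)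
    ...   | inj₁ 1+k<n = 1+k<n , coprime⇒invertible (gcd≡1⇒coprime gcd≡1)
    ...   | inj₂ refl  = contradiction (λ {d} → gcd≡1⇒coprime gcd≡1 {d}) ¬coprime-self

    ∈-reducedResidues⁺ : ∀ {v} → v < n → Invertible (+ v) → v ∈ reducedResidues n
    ∈-reducedResidues⁺ {zero}  _   0-inv =
      contradiction (0-coprimeTo-m⇒m≡1 (invertible⇒coprime 0-inv)) (ℕ.>⇒≢ 1<n)
    ∈-reducedResidues⁺ {suc k} 1+k<n 1+k-inv =
      ∈-map⁺ suc (∈-filter⁺ (coprime-suc? n) (∈-upTo⁺ (ℕ.<-trans (ℕ.n<1+n k) 1+k<n)) (coprime⇒gcd≡1 (invertible⇒coprime 1+k-inv)))

    module _ {b : ℤ} (b-inv : Invertible b) where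

      private
        V = reducedResidues n

        b·_ : ℕ → ℕ
        b· v = (b * + v) %ℕ n

        b·-≈ : ∀ v → + (b· v) ≈ b * + v
        b·-≈ v = %ℕ-≈ (b * + v)

        b·-∈ : ∀ {v} → v ∈ V → b· v ∈ V
        b·-∈ {v} v∈V = ∈-reducedResidues⁺ (n%ℕd<d (b * + v) n)
          (invertible-resp-≈ (≈-sym (b·-≈ v)) (invertible-* b-inv (proj₂ (∈-reducedResidues⁻ v∈V))))

        b·-injective : ∀ {v w} → v ∈ V → w ∈ V → b· v ≡ b· w → v ≡ w
        b·-injective {v} {w} v∈V w∈V b·v≡b·w =
          ≈-<-injective (proj₁ (∈-reducedResidues⁻ v∈V)) (proj₁ (∈-reducedResidues⁻ w∈V))
            (invertible-cancelˡ b-inv (begin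
              b * + v  ≈⟨ b·-≈ v ⟨
              + (b· v) ≡⟨ cong +_ b·v≡b·w ⟩
              + (b· w) ≈⟨ b·-≈ w ⟩
              b * + w  ∎))
          where open ≈-Reasoning

        b·-surjective : ∀ {v} → v ∈ V → v ∈ map b·_ V
        b·-surjective {v} v∈V = subst (_∈ map b·_ V) b·w≡v (∈-map⁺ b·_ w∈V)
          where
          open ≈-Reasoning
          open Invertible b-inv renaming (b⁻¹ to c; b⁻¹*b≈1 to cb≈1)
          w = (c * + v) %ℕ n
          w∈V : w ∈ V
          w∈V = ∈-reducedResidues⁺ (n%ℕd<d (c * + v) n)
            (invertible-resp-≈ (≈-sym (%ℕ-≈ (c * + v)))
              (invertible-* (inverse b (subst (_≈ 1ℤ) (ℤ.*-comm c b) cb≈1)) (proj₂ (∈-reducedResidues⁻ v∈V))))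
          reassociate : ∀ b c v → b * (c * v) ≡ c * b * v
          reassociate = solve-∀
          b·w≡v : b· w ≡ v
          b·w≡v = ≈-<-injective (n%ℕd<d (b * + w) n) (proj₁ (∈-reducedResidues⁻ v∈V)) (begin
            + (b· w)      ≈⟨ b·-≈ w ⟩
            b * + w       ≈⟨ *-cong-≈ (≈-refl {b}) (%ℕ-≈ (c * + v)) ⟩
            b * (c * + v) ≡⟨ reassociate b c (+ v) ⟩
            c * b * + v   ≈⟨ *-cong-≈ cb≈1 (≈-refl {+ v}) ⟩
            1ℤ * + v      ≡⟨ ℤ.*-identityˡ (+ v) ⟩
            + v           ∎)

        b·-permutes : map b·_ V ↭ V
        b·-permutes = ∼bag⇒↭ (unique∧set⇒bag
          (map⁺-Unique-on b·-injective (reducedResidues-unique n)) (reducedResidues-unique n)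
          (mk⇔ b·-closed b·-surjective))
          where
          b·-closed : ∀ {x} → x ∈ map b·_ V → x ∈ V
          b·-closed x∈ with ∈-map⁻ b·_ x∈
          ... | v , v∈V , refl = b·-∈ v∈V

        product-map-b· : ∀ xs → + product (map b·_ xs) ≈ b ^ length xs * + product xs
        product-map-b· []       = ≈-refl
        product-map-b· (x ∷ xs) = begin
          + (b· x ℕ.* product (map b·_ xs))          ≡⟨ ℤ.pos-* (b· x) _ ⟩
          + (b· x) * + product (map b·_ xs)          ≈⟨ *-cong-≈ (b·-≈ x) (product-map-b· xs) ⟩
          b * + x * (b ^ length xs * + product xs)   ≡⟨ interchange b (+ x) (b ^ length xs) (+ product xs) ⟩
          b * b ^ length xs * (+ x * + product xs)   ≡⟨ cong (b * b ^ length xs *_) (ℤ.pos-* x (product xs)) ⟨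
          b ^ suc (length xs) * + (x ℕ.* product xs) ∎
          where
          open ≈-Reasoning
          interchange : ∀ a b c d → a * b * (c * d) ≡ a * c * (b * d)
          interchange = solve-∀

      euler : b ^ φ n ≈ 1ℤ
      euler = invertible-cancelˡ (invertible-product (proj₂ ∘′ ∈-reducedResidues⁻)) (begin
        + P * b ^ φ n         ≡⟨ ℤ.*-comm (+ P) (b ^ φ n) ⟩
        b ^ φ n * + P         ≡⟨ cong (λ k → b ^ k * + P) (length-reducedResidues n) ⟨
        b ^ length V * + P    ≈⟨ product-map-b· V ⟨
        + product (map b·_ V) ≡⟨ cong +_ (product-↭ b·-permutes) ⟩
        + P                   ≡⟨ ℤ.*-identityʳ (+ P) ⟨
        + P * 1ℤ              ∎)
        where
        open ≈-Reasoning
        P = product V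

module Divisibility where

  open import Data.Nat
  open import Data.Nat.Properties
  open import Data.Nat.Divisibility
  open import Data.Nat.DivMod using (_/_; m*n/n≡m)
  open import Data.Nat.Tactic.RingSolver using (solve-∀)
  open import Data.Nat.Coprimality as Coprime using (Coprime; coprime-divisor)
  open import Data.Nat.Primality using (Prime; prime⇒irreducible; prime⇒nonZero; ¬prime[1])
  open import Data.Nat.ListAction using (product)
  open import Data.Nat.ListAction.Properties using (∈⇒∣product)
  open import Data.Fin using (Fin; zero; suc)
  import Data.Fin.Properties as Fin
  open import Data.List.Properties using (map-tabulate)
  open import Data.List.Membership.Propositional.Properties using (∈-map⁺; ∈-allFin)
  open import Data.Product using (_,_)
  open import Data.Sum using (_⊎_; inj₁; inj₂)
  open import Function using (_∘_)
  open import Relation.Nullary using (¬_; yes; no; contradiction)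
  open import Relation.Binary.PropositionalEquality

  coprime-*ʳ : ∀ {a b c} → Coprime a b → Coprime a c → Coprime a (b * c)
  coprime-*ʳ {a} {b} a⊥b a⊥c {d} (d∣a , d∣bc) = a⊥c (d∣a , coprime-divisor d⊥b d∣bc)
    where
    d⊥b : Coprime d b
    d⊥b (e∣d , e∣b) = a⊥b (∣-trans e∣d d∣a , e∣b)

  coprime-^ʳ : ∀ {a b} e → Coprime a b → Coprime a (b ^ e)
  coprime-^ʳ zero    a⊥b (_ , d∣1) = ∣1⇒≡1 d∣1
  coprime-^ʳ (suc e) a⊥b = coprime-*ʳ a⊥b (coprime-^ʳ e a⊥b)

  coprime-^ : ∀ {a b} e f → Coprime a b → Coprime (a ^ e) (b ^ f)
  coprime-^ e f a⊥b = coprime-^ʳ f (Coprime.sym (coprime-^ʳ e (Coprime.sym a⊥b)))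

  prime-≢⇒coprime : ∀ {p q} → Prime p → Prime q → p ≢ q → Coprime p q
  prime-≢⇒coprime {p} pp pq p≢q {d} (d∣p , d∣q) with prime⇒irreducible pp d∣p
  ... | inj₁ d≡1 = d≡1
  ... | inj₂ refl with prime⇒irreducible pq d∣q
  ...   | inj₁ refl = contradiction pp ¬prime[1]
  ...   | inj₂ p≡q  = contradiction p≡q p≢q

  coprime-∣⇒*∣ : ∀ {a b m} → Coprime a b → a ∣ m → b ∣ m → a * b ∣ m
  coprime-∣⇒*∣ {a} {b} a⊥b (divides q refl) b∣qa =
    subst (a * b ∣_) (*-comm a q) (*-monoʳ-∣ a (coprime-divisor (Coprime.sym a⊥b) (subst (b ∣_) (*-comm q a) b∣qa)))

  ∏-suc : ∀ k (f : Fin (suc k) → ℕ) → ∏ (suc k) f ≡ f zero * ∏ k (f ∘ suc)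
  ∏-suc k f = cong (λ xs → f zero * product xs)
    (trans (map-tabulate suc f) (sym (map-tabulate (λ i → i) (f ∘ suc))))

  ∣∏ : ∀ k (f : Fin k → ℕ) i → f i ∣ ∏ k f
  ∣∏ k f i = ∈⇒∣product (∈-map⁺ f (∈-allFin i))

  coprime-∏ : ∀ {a} k (f : Fin k → ℕ) → (∀ i → Coprime a (f i)) → Coprime a (∏ k f)
  coprime-∏ zero    f _      (_ , d∣1) = ∣1⇒≡1 d∣1
  coprime-∏ (suc k) f a⊥f rewrite ∏-suc k f = coprime-*ʳ (a⊥f zero) (coprime-∏ k (f ∘ suc) (a⊥f ∘ suc))

  ∏-∣ : ∀ {m} k (f : Fin k → ℕ) → (∀ {i j} → i ≢ j → Coprime (f i) (f j)) → (∀ i → f i ∣ m) → ∏ k f ∣ m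
  ∏-∣ zero    f _       _   = 1∣ _
  ∏-∣ (suc k) f f-coprime f∣m rewrite ∏-suc k f =
    coprime-∣⇒*∣ (coprime-∏ k (f ∘ suc) (λ i → f-coprime λ ()))
      (f∣m zero) (∏-∣ k (f ∘ suc) (λ i≢j → f-coprime (i≢j ∘ Fin.suc-injective)) (f∣m ∘ suc))

  prime∤⇒coprime : ∀ {p g} → Prime p → ¬ p ∣ g → Coprime p g
  prime∤⇒coprime pp p∤g {d} (d∣p , d∣g) with prime⇒irreducible pp d∣p
  ... | inj₁ d≡1 = d≡1
  ... | inj₂ refl = contradiction d∣g p∤g

  ∣p^s*m⇒p^[1+t]∣⊎∣p^t*m : ∀ {p g} s t m → Prime p → g ∣ p ^ s * m → p ^ suc t ∣ g ⊎ g ∣ p ^ t * m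
  ∣p^s*m⇒p^[1+t]∣⊎∣p^t*m {p} zero t m _ g∣m = inj₂ (∣-trans g∣m (*-monoˡ-∣ m (1∣ (p ^ t))))
  ∣p^s*m⇒p^[1+t]∣⊎∣p^t*m {p} {g} (suc s) t m pp g∣p^[1+s]*m with p ∣? g
  ... | no p∤g = inj₂ (∣n⇒∣m*n (p ^ t)
    (coprime-divisor (coprime-^ʳ (suc s) (Coprime.sym (prime∤⇒coprime pp p∤g))) g∣p^[1+s]*m))
  ... | yes (divides q refl) = divide-out t
    where
    instance _ = prime⇒nonZero pp
    q∣p^s*m : q ∣ p ^ s * m
    q∣p^s*m = *-cancelˡ-∣ p (subst₂ _∣_ (*-comm q p) (*-assoc p (p ^ s) m) g∣p^[1+s]*m)
    divide-out : ∀ t → p ^ suc t ∣ q * p ⊎ q * p ∣ p ^ t * m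
    divide-out zero = inj₁ (subst (_∣ q * p) (sym (*-identityʳ p)) (n∣m*n q))
    divide-out (suc t) with ∣p^s*m⇒p^[1+t]∣⊎∣p^t*m s t m pp q∣p^s*m
    ... | inj₁ p^[1+t]∣q = inj₁ (subst (p ^ suc (suc t) ∣_) (*-comm p q) (*-monoʳ-∣ p p^[1+t]∣q))
    ... | inj₂ q∣p^t*m  = inj₂ (subst₂ _∣_ (*-comm p q) (sym (*-assoc p (p ^ t) m)) (*-monoʳ-∣ p q∣p^t*m))

  m*p^s/p^[s∸[1+t]+1]≡p^t*m : ∀ p {s t} m .{{_ : NonZero p}} → suc t ≤ s →
    _/_ (m * p ^ s) (p ^ (s ∸ suc t + 1)) {{m^n≢0 p (s ∸ suc t + 1)}} ≡ p ^ t * m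
  m*p^s/p^[s∸[1+t]+1]≡p^t*m p {s} {t} m 1+t≤s = begin
    m * p ^ s / p ^ u         ≡⟨ cong (_/ p ^ u) dividend ⟩
    p ^ t * m * p ^ u / p ^ u ≡⟨ m*n/n≡m (p ^ t * m) (p ^ u) ⟩
    p ^ t * m                 ∎
    where
    open ≡-Reasoning
    u = s ∸ suc t + 1
    instance _ = m^n≢0 p u
    regroup : ∀ a b m → m * (a * b) ≡ b * m * a
    regroup = solve-∀
    dividend : m * p ^ s ≡ p ^ t * m * p ^ u
    dividend = begin
      m * p ^ s                   ≡⟨ cong (λ e → m * p ^ e) (m∸n+n≡m 1+t≤s) ⟨
      m * p ^ (s ∸ suc t + suc t) ≡⟨ cong (λ e → m * p ^ e) (+-assoc (s ∸ suc t) 1 t) ⟨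
      m * p ^ (u + t)             ≡⟨ cong (m *_) (^-distribˡ-+-* p u t) ⟩
      m * (p ^ u * p ^ t)         ≡⟨ regroup (p ^ u) (p ^ t) m ⟩
      p ^ t * m * p ^ u           ∎

open import Data.Nat using (ℕ; _∸_; _^_; _≤_; _<_; _+_)
open import Data.Nat.Divisibility using (_∣_)
open import Data.Nat.DivMod using (_/_)
open import Data.Nat.Primality using (Prime; prime⇒nonZero)
open import Data.Nat.Properties using (m^n≢0)
open import Data.Fin using (Fin)
open import Data.Integer using (ℤ; 1ℤ) renaming (_^_ to _^ℤ_)
open import Data.Product using (∃; _×_)
open import Relation.Binary.PropositionalEquality using (_≡_)
open import Relation.Nullary using (¬_)
open import Function.Definitions using (Injective)

open import Data.Nat using (suc; _*_; s≤s; z≤n)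
open import Data.Nat.Properties using (*-comm; _≤?_; n<1⇒n≡0; ≰⇒>)
open import Data.Nat.Divisibility using (divides; 1∣_; ∣-trans)
open import Data.Nat.GCD using (gcd; gcd[m,n]∣m; gcd[m,n]∣n)
open import Data.Nat.Coprimality using (Coprime)
open import Data.Product using (_,_)
open import Data.Sum using ([_,_]′)
open import Function using (_∘_)
open import Relation.Binary.PropositionalEquality using (_≢_; sym; trans; subst; cong)
open import Relation.Nullary using (yes; no; contradiction)
open Divisibility
open Totient using (euler)

prime-power∣φ : ∀ {n p s t r} {b : ℤ} → 1 < n → (pr : Prime p) →
  n ∸ 1 ≡ r * p ^ s → 1 ≤ t → t ≤ s →
  (b ^ℤ (n ∸ 1)) ≡ 1ℤ [mod n ] →
  ¬ ((b ^ℤ _/_ (n ∸ 1) (p ^ (s ∸ t + 1)) {{m^n≢0 p (s ∸ t + 1) {{prime⇒nonZero pr}}}}) ≡ 1ℤ [mod n ]) →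
  p ^ t ∣ φ n
prime-power∣φ {n@(suc (suc k))} {p} {s} {suc t} {r} {b} 1<n@(s≤s (s≤s z≤n)) pr n∸1≡r*p^s (s≤s z≤n) t≤s
  bⁿ⁻¹≡1 b^d≢1 =
  [ (λ p^t∣G → ∣-trans p^t∣G (gcd[m,n]∣n (n ∸ 1) (φ n)))
  , (λ G∣p^t*r → contradiction (≈⇒mod (^-∣-≈1 b (subst (G ∣_) (sym d≡p^t*r) G∣p^t*r) b^G≈1)) b^d≢1)
  ]′ (∣p^s*m⇒p^[1+t]∣⊎∣p^t*m s t r pr G∣p^s*r)
  where
  open ModularArithmetic n
  instance
    p≢0   = prime⇒nonZero pr
    p^u≢0 = m^n≢0 p (s ∸ suc t + 1)
  G = gcd (n ∸ 1) (φ n)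
  bⁿ⁻¹≈1 : b ^ℤ (n ∸ 1) ≈ 1ℤ
  bⁿ⁻¹≈1 = mod⇒≈ bⁿ⁻¹≡1
  b^G≈1 : b ^ℤ G ≈ 1ℤ
  b^G≈1 = ^-gcd-≈1 b (n ∸ 1) (φ n) bⁿ⁻¹≈1 (euler 1<n (^-suc≈1⇒invertible b k bⁿ⁻¹≈1))
  G∣p^s*r : G ∣ p ^ s * r
  G∣p^s*r = subst (G ∣_) (trans n∸1≡r*p^s (*-comm r (p ^ s))) (gcd[m,n]∣m (n ∸ 1) (φ n))
  d≡p^t*r : (n ∸ 1) / p ^ (s ∸ suc t + 1) ≡ p ^ t * r
  d≡p^t*r = trans (cong (_/ p ^ (s ∸ suc t + 1)) n∸1≡r*p^s) (m*p^s/p^[s∸[1+t]+1]≡p^t*m p r t≤s)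

theorem4p3 : (n : ℕ) → 1 < n →
    (k : ℕ) (p s t : Fin k → ℕ) →
    (pr : ∀ i → Prime (p i)) →
    Injective _≡_ _≡_ p →
    (∀ i → 1 ≤ s i) →
    n ∸ 1 ≡ ∏ k (λ i → p i ^ s i) →
    (∀ i → t i ≤ s i) →
    (∏ k (λ i → p i ^ t i) ∣ φ n → Prime n) →
    (∀ i → 1 ≤ t i →
      ∃ λ (b : ℤ) →
        (b ^ℤ (n ∸ 1)) ≡ 1ℤ [mod n ] ×
        ¬ ((b ^ℤ _/_ (n ∸ 1) (p i ^ (s i ∸ t i + 1)) {{m^n≢0 (p i) (s i ∸ t i + 1) {{prime⇒nonZero (pr i)}}}}) ≡ 1ℤ [mod n ])) →
    Prime n
theorem4p3 n 1<n k p s t pr p-injective _ n∸1≡∏ t≤s m∣φ⇒prime witness =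
  m∣φ⇒prime (∏-∣ k (λ i → p i ^ t i) prime-powers-coprime p^t∣φ)
  where
  prime-powers-coprime : ∀ {i j} → i ≢ j → Coprime (p i ^ t i) (p j ^ t j)
  prime-powers-coprime {i} {j} i≢j = coprime-^ (t i) (t j) (prime-≢⇒coprime (pr i) (pr j) (i≢j ∘ p-injective))
  p^t∣φ : ∀ i → p i ^ t i ∣ φ n
  p^t∣φ i with 1 ≤? t i | ∣∏ k (λ j → p j ^ s j) i
  ... | no  t≱1 | _ = subst (λ e → p i ^ e ∣ φ n) (sym (n<1⇒n≡0 (≰⇒> t≱1))) (1∣ φ n)
  ... | yes t≥1 | divides r ∏≡r*p^s with witness i t≥1
  ...   | b , bⁿ⁻¹≡1 , b^d≢1 = prime-power∣φ {r = r} 1<n (pr i) (trans n∸1≡∏ ∏≡r*p^s) t≥1 (t≤s i) bⁿ⁻¹≡1 b^d≢1
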